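{- Let $B$ be a $\wedge_d$-OBDD obeying a linear order $\pi$ (containing $\mathsf{var}(B)$), and let ${\bf g}$ be an assignment whose domain is a prefix of $\pi$. Assume $\mathcal{S}(B)|_{\bf g}\neq\emptyset$. Let $X=(\mathsf{var}(B)\setminus\mathsf{var}({\bf g}))\setminus\bigcup_{u\in L({\bf g})}\mathsf{var}(B_u)$. If $L({\bf g})\neq\emptyset$ then $\mathcal{S}(B)|_{\bf g}=\{0,1\}^X\times\prod_{u\in L({\bf g})}\mathcal{S}(B_u)$. Otherwise $\mathcal{S}(B)|_{\bf g}=\{0,1\}^X$.
   Context: An assignment ${\bf a}$ is a map from a finite set $\mathsf{var}({\bf a})$ of variables to $\{0,1\}$, identified with the set of pairs $(x,{\bf a}(x))$; $\{0,1\}^X$ is the set of all assignments to $X$ ($\{0,1\}^{\emptyset}=\{\emptyset\}$). For sets of assignments over disjoint variable sets, $\mathcal{H}_1\times\mathcal{H}_2=\{{\bf a}\cup{\bf b}:{\bf a}\in\mathcal{H}_1,{\bf b}\in\mathcal{H}_2\}$, extended to products $\prod$. For a uniform set $\mathcal{H}$ of assignments over $\mathsf{var}(\mathcal{H})$ and an assignment ${\bf a}$, let ${\bf a}'$ be the restriction of ${\bf a}$ to $\mathsf{var}({\bf a})\cap\mathsf{var}(\mathcal{H})$; then $\mathcal{H}|_{\bf a}=\{{\bf b}\setminus{\bf a}':{\bf b}\in\mathcal{H},{\bf a}'\subseteq{\bf b}\}$. A $\wedge_d$-FBDD is a DAG $B$ with a single source and two sinks labelled ${\bf 0}$, ${\bf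 1}$; each non-sink node has two children and is either a conjunction node or a decision node labelled by a variable whose outgoing edges are labelled $0$ and $1$. For a node $u$ of a DAG $D$, $D_u$ is the sub-DAG induced by nodes reachable from $u$, and $\mathsf{var}(D_u)$ the set of variables labelling its decision nodes. Requirements: for every conjunction node with children $u_0,u_1$, $\mathsf{var}(B_{u_0})\cap\mathsf{var}(B_{u_1})=\emptyset$; no directed path has two decision nodes with the same label. Accepted assignments $\mathcal{A}(B)$: $\{\emptyset\}$ for a ${\bf 1}$-sink, $\emptyset$ for a ${\bf 0}$-sink, $\mathcal{A}(B_{u_0})\times\{(x,0)\}\cup\mathcal{A}(B_{u_1})\times\{(x,1)\}$ for a source decision node labelled $x$ with $0$-child $u_0$ and $1$-child $u_1$, and $\mathcal{A}(B_{u_0})\times\mathcal{A}(B_{u_1})$ for a source conjunction node. $\mathcal{S}(B)$ is the set of assignments to $\mathsf{var}(B)$ extending some element of $\mathcal{A}(B)$. $B$ is a $\wedge_d$-OBDD obeying a linear order $\pi$ of a superset of $\mathsf{var}(B)$ if along every directed path decision-node labels appear in increasing $\pi$-order. The alignment $B[{\bf g}]$ is obtained from $B$ by deleting, for each decision node labelled by $x\in\mathsf{var}({\bf g})$, its outgoing edge labelled $1-{\bf g}(x)$, then deleting all nodes unreachable from the source. A decision node of $B[{\bf g}]$ is incomplete if it has only one outgoing edge in $B[{\bf g}]$, complete otherwise. $L({\bf g})$ is the set of complete decision nodes $w$ of $B[{\bf g}]$ such that $B[{\bf g}]$ has a directed path from the source to $w$ on which all decision nodes other than $w$ are incomplete.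 -}

module Defs where

open import Data.Nat using (ℕ; _≡ᵇ_)
open import Data.Bool using (Bool; true; false; not; if_then_else_)
open import Data.Maybe using (Maybe; just; nothing)
open import Data.Fin using (Fin) renaming (_<_ to _<ᶠ_)
open import Data.List using (List; length; lookup; take)
open import Data.List.Membership.Propositional using (_∈_)
open import Data.List.Relation.Unary.Unique.Propositional using (Unique)
open import Data.Product using (Σ; ∃; ∃-syntax; _×_; _,_)
open import Data.Product using (∃₂)
open import Data.Sum using (_⊎_)
open import Relation.Nullary using (¬_)
open import Relation.Binary.PropositionalEquality using (_≡_; _≢_)
open import Relation.Binary.Construct.Closure.ReflexiveTransitive using (Star)
open import Relation.Binary.Construct.Closure.Transitive using (TransClosure)
open import Function.Bundles using (_⇔_)

-- Variables are natural numbers; an assignment is a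
-- partial map ℕ → {0,1} (Bool: false = 0, true = 1); its domain var(a)
-- is the set of x with a x ≡ just _.  A set of assignments is a
-- predicate on assignments.

Asg : Set
Asg = ℕ → Maybe Bool

Dom : Asg → ℕ → Set
Dom a x = ∃[ v ] (a x ≡ just v)

_⊆ₐ_ : Asg → Asg → Set
a ⊆ₐ b = ∀ x v → a x ≡ just v → b x ≡ just v

single : ℕ → Bool → Asg
single x v y = if y ≡ᵇ x then just v else nothing

Single : ℕ → Bool → Asg → Set
Single x v s = ∀ y → s y ≡ single x v y

Union : Asg → Asg → Asg → Set
Union a b c = ∀ x v → (a x ≡ just v) ⇔ (b x ≡ just v ⊎ c x ≡ just v)

DisjointAsg : Asg → Asg → Set
DisjointAsg b c = ∀ x → b x ≡ nothing ⊎ c x ≡ nothing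

_⊠_ : (Asg → Set) → (Asg → Set) → Asg → Set
(H₁ ⊠ H₂) a = ∃[ b ] ∃[ c ] (H₁ b × H₂ c × DisjointAsg b c × Union a b c)

Cube : (ℕ → Set) → Asg → Set
Cube X a = ∀ x → Dom a x ⇔ X x

_≐_ : (Asg → Set) → (Asg → Set) → Set
P ≐ Q = ∀ a → P a ⇔ Q a

-- Restriction H|_g where H is uniform over the variable set V = var(H):
-- { b ∖ g' : b ∈ H, g' ⊆ b }, g' = restriction of g to var(g) ∩ V.
Restrict : (V : ℕ → Set) → (Asg → Set) → Asg → Asg → Set
Restrict V H g c =
  ∃[ b ] ( H b
         × (∀ x v → V x → g x ≡ just v → b x ≡ just v)
         × (∀ x → V x × Dom g x → c x ≡ nothing)
         × (∀ x → ¬ (V x × Dom g x) → c x ≡ b x))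

-- DAGs with nodes Fin n.  Each node is a sink (labelled by a Bool:
-- false = 𝟎, true = 𝟏), a decision node (variable, 0-child, 1-child)
-- or a conjunction node (two children).

data Kind (n : ℕ) : Set where
  sink : Bool → Kind n
  dec  : ℕ → Fin n → Fin n → Kind n
  conj : Fin n → Fin n → Kind n

pick : ∀ {n} → Bool → Fin n → Fin n → Fin n
pick b u₀ u₁ = if b then u₁ else u₀

module _ {n : ℕ} (lab : Fin n → Kind n) where

  -- edges of the DAG (the edge of a decision node out to pick b u₀ u₁
  -- is the edge labelled b)
  data Edge : Fin n → Fin n → Set where
    e-dec  : ∀ {u x u₀ u₁} (b : Bool) → lab u ≡ dec x u₀ u₁ → Edge u (pick b u₀ u₁)
    e-conj : ∀ {u u₀ u₁} (b : Bool) → lab u ≡ conj u₀ u₁ → Edge u (pick b u₀ u₁)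

  Reach : Fin n → Fin n → Set
  Reach = Star Edge

  Acyclic : Set
  Acyclic = ∀ u → ¬ TransClosure Edge u u

  IsDec : Fin n → ℕ → Set
  IsDec w x = ∃[ u₀ ] ∃[ u₁ ] (lab w ≡ dec x u₀ u₁)

  Var : Fin n → ℕ → Set
  Var u x = ∃[ w ] (Reach u w × IsDec w x)

  IsFBDD : Fin n → Set
  IsFBDD root =
      (∀ u u₀ u₁ → Reach root u → lab u ≡ conj u₀ u₁ →
         ∀ x → ¬ (Var u₀ x × Var u₁ x))
    × (∀ w w' x → Reach root w → TransClosure Edge w w' →
         IsDec w x → ¬ IsDec w' x)

  Before : List ℕ → ℕ → ℕ → Set
  Before π x y = ∃[ i ] ∃[ j ] (i <ᶠ j × lookup π i ≡ x × lookup π j ≡ y)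

  Obeys : Fin n → List ℕ → Set
  Obeys root π = ∀ w w' x x' → Reach root w → TransClosure Edge w w' →
                  IsDec w x → IsDec w' x' → Before π x x'

  data Acc : Fin n → Asg → Set where
    acc-1    : ∀ {u a} → lab u ≡ sink true → (∀ x → a x ≡ nothing) → Acc u a
    acc-dec  : ∀ {u x u₀ u₁ a} → lab u ≡ dec x u₀ u₁ → (v : Bool) →
               (Acc (pick v u₀ u₁) ⊠ Single x v) a → Acc u a
    acc-conj : ∀ {u u₀ u₁ a} → lab u ≡ conj u₀ u₁ →
               (Acc u₀ ⊠ Acc u₁) a → Acc u a

  Sol : Fin n → Asg → Set
  Sol u c = (∀ x → Dom c x ⇔ Var u x) × ∃[ a ] (Acc u a × a ⊆ₐ c)

  Kept : Asg → ℕ → Bool → Set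
  Kept g x b = ¬ (g x ≡ just (not b))

  data EdgeG (g : Asg) : Fin n → Fin n → Set where
    eg-dec  : ∀ {u x u₀ u₁} (b : Bool) → lab u ≡ dec x u₀ u₁ → Kept g x b →
              EdgeG g u (pick b u₀ u₁)
    eg-conj : ∀ {u u₀ u₁} (b : Bool) → lab u ≡ conj u₀ u₁ →
              EdgeG g u (pick b u₀ u₁)

  InAlign : Fin n → Asg → Fin n → Set
  InAlign root g w = Star (EdgeG g) root w

  Complete : Fin n → Asg → Fin n → Set
  Complete root g w = InAlign root g w ×
                      ∃[ x ] (IsDec w x × Kept g x false × Kept g x true)

  IncEdge : Fin n → Asg → Fin n → Fin n → Set
  IncEdge root g u v = EdgeG g u v × ¬ Complete root g u

  InL : Fin n → Asg → Fin n → Set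
  InL root g w = Complete root g w × Star (IncEdge root g) root w

  XSet : Fin n → Asg → ℕ → Set
  XSet root g x = Var root x × ¬ Dom g x × (∀ u → InL root g u → ¬ Var u x)

  ProdL : Fin n → Asg → Asg → Set
  ProdL root g a =
    Σ Asg λ c → Σ (Fin n → Asg) λ bs → ( Cube (XSet root g) c
                   × (∀ u → InL root g u → Sol u (bs u))
                   × (∀ x v → (a x ≡ just v) ⇔
                        (c x ≡ just v ⊎ ∃[ u ] (InL root g u × bs u x ≡ just v))))

module Submission where

-- A decision node of B[g] is complete exactly when g leaves its label
-- unassigned; as var(g) is a prefix of π and B obeys π, g then assigns no
-- variable of B_u at all.  Walking from the source of B[g] along edges out of
-- incomplete nodes, an accepted assignment that agrees with g splits at
-- conjunction nodes and follows the edge chosen by g at decision nodes, until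
-- it reaches the nodes of L(g), where it yields accepted assignments of the
-- B_u.  Conversely, accepted assignments of the B_u glue back together along
-- the same walk, which meets no 𝟎-sink because 𝒮(B)|_g is non-empty.  No node
-- on the walk tests a variable of X, so those variables are free.

open import Defs
open import Data.Nat as ℕ using (ℕ; _≡ᵇ_; s≤s)
open import Data.Nat.Properties using (≡ᵇ⇒≡; ≡⇒≡ᵇ)
open import Data.Bool using (Bool; true; false; not; T) renaming (_≟_ to _≟ᵇ_)
open import Data.Maybe using (just; nothing)
open import Data.Maybe.Properties using (just-injective; ≡-dec)
open import Data.Fin using (Fin; zero; suc) renaming (_≟_ to _≟ᶠ_; _<_ to _<ᶠ_)
open import Data.Fin.Properties using (any?; all?)
open import Data.Fin.Induction using (spo-noetherian)
open import Data.List using (List; _∷_; take; length; lookup)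
open import Data.List.Membership.Propositional using (_∈_)
open import Data.List.Relation.Unary.Any using (here; there)
import Data.List.Relation.Unary.All as All
open import Data.List.Membership.Propositional.Properties using (∈-lookup)
open import Data.List.Relation.Unary.AllPairs using (_∷_)
open import Data.List.Relation.Unary.Unique.Propositional using (Unique)
open import Data.Product using (∃; ∃-syntax; _×_; _,_; proj₁; proj₂)
open import Data.Sum using (_⊎_; inj₁; inj₂)
open import Data.Empty using (⊥-elim)
open import Level using (0ℓ)
open import Relation.Nullary using (¬_; Dec; yes; no)
open import Relation.Nullary.Decidable using (map′; _×-dec_; _⊎-dec_; ¬?; _→-dec_)
open import Relation.Unary using (Pred; Decidable)
open import Relation.Binary using (Rel; _⇒_) renaming (Decidable to Decidable₂)
open import Relation.Binary.PropositionalEquality using (_≡_; _≢_; refl; sym; trans; subst; isEquivalence)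
open import Relation.Binary.Construct.Closure.ReflexiveTransitive using (Star; ε; _◅_; _◅◅_; map)
open import Relation.Binary.Construct.Closure.Transitive using (TransClosure; [_]; _∷_; _++_)
open import Induction.WellFounded using (WellFounded) renaming (Acc to Accessible; acc to accessible)
open import Function using (id; flip; _∘_; case_of_; mk⇔; Equivalence)
open import Function.Bundles using (_⇔_)
open import Function.Construct.Composition using (_⇔-∘_)

open Equivalence

dom? : ∀ a → Decidable (Dom a)
dom? a x with a x
... | just v = yes (v , refl)
... | nothing = no λ ()

nothing⇒∉dom : ∀ {a x} → a x ≡ nothing → ¬ Dom a x
nothing⇒∉dom ax (_ , ax′) = case trans (sym ax) ax′ of λ ()

⊆ₐ-refl : ∀ {a} → a ⊆ₐ a
⊆ₐ-refl _ _ ax = ax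

⊆ₐ-trans : ∀ {a b c} → a ⊆ₐ b → b ⊆ₐ c → a ⊆ₐ c
⊆ₐ-trans a⊆b b⊆c x v = b⊆c x v ∘ a⊆b x v

single-just⁻ : ∀ {x v y w} → single x v y ≡ just w → y ≡ x × v ≡ w
single-just⁻ {x} {v} {y} eq with y ≡ᵇ x in y≡ᵇx
... | true = ≡ᵇ⇒≡ y x (subst T (sym y≡ᵇx) _) , just-injective eq

single-self : ∀ x v → single x v x ≡ just v
single-self x v with x ≡ᵇ x in x≡ᵇx
... | true = refl
... | false = ⊥-elim (subst T x≡ᵇx (≡⇒≡ᵇ x x refl))

single-other : ∀ {x v y} → y ≢ x → single x v y ≡ nothing
single-other {x} {v} {y} y≢x with y ≡ᵇ x in y≡ᵇx
... | true = ⊥-elim (y≢x (≡ᵇ⇒≡ y x (subst T (sym y≡ᵇx) _)))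
... | false = refl

single-⊆ : ∀ {x v b} → b x ≡ just v → single x v ⊆ₐ b
single-⊆ {x} {v} bx y w eq with single-just⁻ {x} {v} {y} eq
... | refl , refl = bx

_∪ₐ_ : Asg → Asg → Asg
(a ∪ₐ b) y with a y
... | just v = just v
... | nothing = b y

∪ₐ-justˡ : ∀ {a b y v} → a y ≡ just v → (a ∪ₐ b) y ≡ just v
∪ₐ-justˡ {a} {y = y} ay with a y
∪ₐ-justˡ refl | just _ = refl

∪ₐ-nothingˡ : ∀ {a b y} → a y ≡ nothing → (a ∪ₐ b) y ≡ b y
∪ₐ-nothingˡ {a} {y = y} ay with a y
∪ₐ-nothingˡ refl | nothing = refl

∪ₐ-just⁻ : ∀ {a b y v} → (a ∪ₐ b) y ≡ just v → a y ≡ just v ⊎ b y ≡ just v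
∪ₐ-just⁻ {a} {y = y} eq with a y
... | just _ = inj₁ eq
... | nothing = inj₂ eq

∪ₐ-⊆ : ∀ {a b c} → a ⊆ₐ c → b ⊆ₐ c → (a ∪ₐ b) ⊆ₐ c
∪ₐ-⊆ {a} {b} a⊆c b⊆c y v eq with ∪ₐ-just⁻ {a} {b} eq
... | inj₁ ay = a⊆c y v ay
... | inj₂ by = b⊆c y v by

∪ₐ-union : ∀ {a b} → DisjointAsg a b → Union (a ∪ₐ b) a b
∪ₐ-union {a} {b} disj y v = mk⇔ (∪ₐ-just⁻ {a} {b}) join
  where
  join : a y ≡ just v ⊎ b y ≡ just v → (a ∪ₐ b) y ≡ just v
  join (inj₁ ay) = ∪ₐ-justˡ {a} {b} ay
  join (inj₂ by) with disj y
  ... | inj₁ ay = trans (∪ₐ-nothingˡ {a} {b} ay) by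
  ... | inj₂ by′ = case trans (sym by′) by of λ ()

_↾_ : {P : Pred ℕ 0ℓ} → Asg → Decidable P → Asg
(b ↾ P?) y with P? y
... | yes _ = b y
... | no _ = nothing

module _ {P : Pred ℕ 0ℓ} (P? : Decidable P) (b : Asg) where

  ↾-inside : ∀ {y} → P y → (b ↾ P?) y ≡ b y
  ↾-inside {y} py with P? y
  ... | yes _ = refl
  ... | no ¬py = ⊥-elim (¬py py)

  ↾-just⁻ : ∀ {y v} → (b ↾ P?) y ≡ just v → P y × b y ≡ just v
  ↾-just⁻ {y} eq with P? y
  ... | yes py = py , eq

  ↾-outside : ∀ {y} → ¬ (P y × Dom b y) → (b ↾ P?) y ≡ nothing
  ↾-outside {y} ¬p with P? y
  ... | no _ = refl
  ... | yes py with b y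
  ...   | nothing = refl
  ...   | just v = ⊥-elim (¬p (py , v , refl))

  ↾-dom : (∀ {y} → P y → Dom b y) → ∀ y → Dom (b ↾ P?) y ⇔ P y
  ↾-dom P⊆b y = mk⇔ (λ (_ , eq) → proj₁ (↾-just⁻ eq))
                     (λ py → let (v , by) = P⊆b py in v , trans (↾-inside py) by)

∈-take-before : ∀ {π : List ℕ} k → Unique π → {i j : Fin (length π)} → i <ᶠ j →
                lookup π j ∈ take k π → lookup π i ∈ take k π
∈-take-before {p ∷ _} (ℕ.suc k) _ {zero} _ _ = here refl
∈-take-before {p ∷ _} (ℕ.suc k) (p∉ ∷ _) {suc _} {suc j} _ (here eq) =
  ⊥-elim (All.lookup p∉ (∈-lookup j) (sym eq))
∈-take-before {p ∷ _} (ℕ.suc k) (_ ∷ unique) {suc _} {suc _} (s≤s i<j) (there mem) =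
  there (∈-take-before k unique i<j mem)

module _ {A : Set} {R : Rel A 0ℓ} where

  ◅⁺ : ∀ {u v w} → R u v → Star R v w → TransClosure R u w
  ◅⁺ r ε = [ r ]
  ◅⁺ r (r′ ◅ p) = r ∷ ◅⁺ r′ p

  star⇒≡⊎⁺ : ∀ {u w} → Star R u w → u ≡ w ⊎ TransClosure R u w
  star⇒≡⊎⁺ ε = inj₁ refl
  star⇒≡⊎⁺ (r ◅ p) = inj₂ (◅⁺ r p)

module _ {n} {E : Rel (Fin n) 0ℓ} (acyclic : ∀ u → ¬ TransClosure E u u) where

  acyclic⇒noetherian : WellFounded (flip (TransClosure E))
  acyclic⇒noetherian = spo-noetherian {_≈_ = _≡_} (record
    { isEquivalence = isEquivalence
    ; irrefl = λ { refl → acyclic _ }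
    ; trans = _++_
    ; <-resp-≈ = (λ { refl p → p }) , (λ { refl p → p })
    })

  module _ {R : Rel (Fin n) 0ℓ} (R⇒E : R ⇒ E) (R? : Decidable₂ R) where

    star? : Decidable₂ (Star R)
    star? u = go u (acyclic⇒noetherian u)
      where
      go : ∀ u → Accessible (flip (TransClosure E)) u → ∀ v → Dec (Star R u v)
      go u (accessible rec) v with u ≟ᶠ v
      ... | yes refl = yes ε
      ... | no u≢v = map′ (λ (w , r , p) → r ◅ p) uncons (any? step)
        where
        step : ∀ w → Dec (R u w × Star R w v)
        step w with R? u w
        ... | yes r = map′ (r ,_) proj₂ (go w (rec [ R⇒E r ]) v)
        ... | no ¬r = no (¬r ∘ proj₁)
        uncons : Star R u v → ∃[ w ] (R u w × Star R w v)
        uncons ε = ⊥-elim (u≢v refl)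
        uncons (r ◅ p) = _ , r , p

∃-Bool? : {P : Bool → Set} → (∀ b → Dec (P b)) → Dec (∃ P)
∃-Bool? P? = map′ (λ { (inj₁ p) → false , p ; (inj₂ p) → true , p })
                  (λ { (false , p) → inj₁ p ; (true , p) → inj₂ p })
                  (P? false ⊎-dec P? true)

module _ {n} (lab : Fin n → Kind n) where

  reach-var : ∀ {u w x} → Reach lab u w → Var lab w x → Var lab u x
  reach-var r (w′ , r′ , d) = w′ , r ◅◅ r′ , d

  isDec-functional : ∀ {w x y} → IsDec lab w x → IsDec lab w y → x ≡ y
  isDec-functional (_ , _ , e) (_ , _ , e′) with trans (sym e) e′
  ... | refl = refl

  acc-var : ∀ {u a y} → Acc lab u a → Dom a y → Var lab u y
  acc-var (acc-1 _ empty) (_ , ay) = case trans (sym (empty _)) ay of λ ()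
  acc-var {y = y} (acc-dec {x = x} eq v (_ , _ , A₁ , S , _ , un)) (w , ay) with to (un y w) ay
  ... | inj₁ a₁y = reach-var (e-dec v eq ◅ ε) (acc-var A₁ (w , a₁y))
  ... | inj₂ sy with single-just⁻ {x} {v} {y} (trans (sym (S y)) sy)
  ...   | refl , _ = _ , ε , _ , _ , eq
  acc-var (acc-conj eq (_ , _ , A₀ , A₁ , _ , un)) (w , ay) with to (un _ w) ay
  ... | inj₁ a₀y = reach-var (e-conj false eq ◅ ε) (acc-var A₀ (w , a₀y))
  ... | inj₂ a₁y = reach-var (e-conj true eq ◅ ε) (acc-var A₁ (w , a₁y))

  ¬acc-0-sink : ∀ {z a} → lab z ≡ sink false → ¬ Acc lab z a
  ¬acc-0-sink eq (acc-1 eq′ _) = case trans (sym eq) eq′ of λ ()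
  ¬acc-0-sink eq (acc-dec eq′ _ _) = case trans (sym eq) eq′ of λ ()
  ¬acc-0-sink eq (acc-conj eq′ _) = case trans (sym eq) eq′ of λ ()

  acc-dec⁻ : ∀ {z x u₀ u₁ a} → lab z ≡ dec x u₀ u₁ → Acc lab z a →
             ∃[ v ] ∃[ a₁ ] (Acc lab (pick v u₀ u₁) a₁ × a₁ ⊆ₐ a × a x ≡ just v)
  acc-dec⁻ eq (acc-1 eq′ _) = case trans (sym eq) eq′ of λ ()
  acc-dec⁻ eq (acc-conj eq′ _) = case trans (sym eq) eq′ of λ ()
  acc-dec⁻ {x = x} eq (acc-dec eq′ v (a₁ , _ , A₁ , S , _ , un)) with trans (sym eq) eq′
  ... | refl = v , a₁ , A₁ , (λ y w e → from (un y w) (inj₁ e)) ,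
               from (un x v) (inj₂ (trans (S x) (single-self x v)))

  acc-conj⁻ : ∀ {z u₀ u₁ a} → lab z ≡ conj u₀ u₁ → Acc lab z a →
              ∀ c → ∃[ a′ ] (Acc lab (pick c u₀ u₁) a′ × a′ ⊆ₐ a)
  acc-conj⁻ eq (acc-1 eq′ _) = case trans (sym eq) eq′ of λ ()
  acc-conj⁻ eq (acc-dec eq′ _ _) = case trans (sym eq) eq′ of λ ()
  acc-conj⁻ eq (acc-conj eq′ (a₀ , a₁ , A₀ , A₁ , _ , un)) c with trans (sym eq) eq′ | c
  ... | refl | false = a₀ , A₀ , λ y w e → from (un y w) (inj₁ e)
  ... | refl | true = a₁ , A₁ , λ y w e → from (un y w) (inj₂ e)

  acc-disjoint : ∀ {u₀ u₁ a₀ a₁} → (∀ y → ¬ (Var lab u₀ y × Var lab u₁ y)) →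
                 Acc lab u₀ a₀ → Acc lab u₁ a₁ → DisjointAsg a₀ a₁
  acc-disjoint {a₀ = a₀} {a₁} var-disjoint A₀ A₁ y with a₀ y in a₀y | a₁ y in a₁y
  ... | nothing | _ = inj₁ refl
  ... | just _ | nothing = inj₂ refl
  ... | just v₀ | just v₁ = ⊥-elim (var-disjoint y (acc-var A₀ (v₀ , a₀y) , acc-var A₁ (v₁ , a₁y)))

  acc-conj-∪ : ∀ {z u₀ u₁ a₀ a₁} → lab z ≡ conj u₀ u₁ →
               (∀ y → ¬ (Var lab u₀ y × Var lab u₁ y)) →
               Acc lab u₀ a₀ → Acc lab u₁ a₁ → Acc lab z (a₀ ∪ₐ a₁)
  acc-conj-∪ {a₀ = a₀} {a₁} eq var-disjoint A₀ A₁ =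
    acc-conj eq (_ , _ , A₀ , A₁ , disjoint , ∪ₐ-union disjoint)
    where
    disjoint : DisjointAsg a₀ a₁
    disjoint = acc-disjoint var-disjoint A₀ A₁

  acc-dec-∪ : ∀ {z x u₀ u₁ v a₁} → lab z ≡ dec x u₀ u₁ → ¬ Var lab (pick v u₀ u₁) x →
              Acc lab (pick v u₀ u₁) a₁ → Acc lab z (a₁ ∪ₐ single x v)
  acc-dec-∪ {x = x} {v = v} {a₁} eq x∉ A₁ =
    acc-dec eq v (_ , _ , A₁ , (λ _ → refl) , disjoint , ∪ₐ-union disjoint)
    where
    disjoint : DisjointAsg a₁ (single x v)
    disjoint y with a₁ y in a₁y
    ... | nothing = inj₁ refl
    ... | just w = inj₂ (single-other {x} {v} {y} λ { refl → x∉ (acc-var A₁ (w , a₁y)) })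

  kept-value : ∀ {g x c w} → Kept lab g x c → g x ≡ just w → w ≡ c
  kept-value {c = false} {false} _ _ = refl
  kept-value {c = true} {true} _ _ = refl
  kept-value {c = false} {true} kept gx = ⊥-elim (kept gx)
  kept-value {c = true} {false} kept gx = ⊥-elim (kept gx)

  assigned⇒kept : ∀ {g x w} → g x ≡ just w → Kept lab g x w
  assigned⇒kept {w = false} gx e = case trans (sym gx) e of λ ()
  assigned⇒kept {w = true} gx e = case trans (sym gx) e of λ ()

  unassigned⇒kept : ∀ {g x c} → g x ≡ nothing → Kept lab g x c
  unassigned⇒kept gx e = case trans (sym gx) e of λ ()

  kept-both⇒unassigned : ∀ {g x} → Kept lab g x false → Kept lab g x true → g x ≡ nothing
  kept-both⇒unassigned {g} {x} kept₀ kept₁ with g x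
  ... | nothing = refl
  ... | just false = ⊥-elim (kept₁ refl)
  ... | just true = ⊥-elim (kept₀ refl)

  edgeG⇒edge : ∀ {g u v} → EdgeG lab g u v → Edge lab u v
  edgeG⇒edge (eg-dec b eq _) = e-dec b eq
  edgeG⇒edge (eg-conj b eq) = e-conj b eq

  kept? : ∀ g x b → Dec (Kept lab g x b)
  kept? g x b = ¬? (≡-dec _≟ᵇ_ (g x) (just (not b)))

  edgeG? : ∀ g → Decidable₂ (EdgeG lab g)
  edgeG? g u v with lab u in eq
  ... | sink _ = no λ { (eg-dec _ eq′ _) → case trans (sym eq) eq′ of λ ()
                      ; (eg-conj _ eq′) → case trans (sym eq) eq′ of λ () }
  ... | dec x u₀ u₁ = map′ (λ { (b , k , refl) → eg-dec b eq k }) inv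
                           (∃-Bool? λ b → kept? g x b ×-dec v ≟ᶠ pick b u₀ u₁)
    where
    inv : EdgeG lab g u v → ∃[ b ] (Kept lab g x b × v ≡ pick b u₀ u₁)
    inv (eg-dec b eq′ k) with trans (sym eq) eq′
    ... | refl = b , k , refl
    inv (eg-conj _ eq′) = case trans (sym eq) eq′ of λ ()
  ... | conj u₀ u₁ = map′ (λ { (b , refl) → eg-conj b eq }) inv
                          (∃-Bool? λ b → v ≟ᶠ pick b u₀ u₁)
    where
    inv : EdgeG lab g u v → ∃[ b ] (v ≡ pick b u₀ u₁)
    inv (eg-conj b eq′) with trans (sym eq) eq′
    ... | refl = b , refl
    inv (eg-dec _ eq′ _) = case trans (sym eq) eq′ of λ ()

  edge? : Decidable₂ (Edge lab)
  edge? u v = map′ edgeG⇒edge all-kept (edgeG? (λ _ → nothing) u v)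
    where
    all-kept : Edge lab u v → EdgeG lab (λ _ → nothing) u v
    all-kept (e-dec b eq) = eg-dec b eq λ ()
    all-kept (e-conj b eq) = eg-conj b eq

  isDec? : ∀ w x → Dec (IsDec lab w x)
  isDec? w x with lab w
  ... | sink _ = no λ { (_ , _ , ()) }
  ... | conj _ _ = no λ { (_ , _ , ()) }
  ... | dec y _ _ = map′ (λ { refl → _ , _ , refl }) (λ { (_ , _ , refl) → refl }) (y ℕ.≟ x)

  module _ (acyclic : Acyclic lab) where

    reach? : Decidable₂ (Reach lab)
    reach? = star? acyclic id edge?

    var? : ∀ u → Decidable (Var lab u)
    var? u x = any? λ w → reach? u w ×-dec isDec? w x

module Alignment {n} (lab : Fin n → Kind n) (acyclic : Acyclic lab) (root : Fin n) (g : Asg) where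

  inAlign⇒reach : ∀ {w} → InAlign lab root g w → Reach lab root w
  inAlign⇒reach = map (edgeG⇒edge lab)

  incPath⇒inAlign : ∀ {w} → Star (IncEdge lab root g) root w → InAlign lab root g w
  incPath⇒inAlign = map proj₁

  incPath⇒reach : ∀ {w} → Star (IncEdge lab root g) root w → Reach lab root w
  incPath⇒reach = inAlign⇒reach ∘ incPath⇒inAlign

  complete⇒unassigned : ∀ {w} → Complete lab root g w → ∃[ x ] (IsDec lab w x × g x ≡ nothing)
  complete⇒unassigned (_ , x , w-x , kept₀ , kept₁) =
    x , w-x , kept-both⇒unassigned lab {g} {x} kept₀ kept₁

  incomplete⇒assigned : ∀ {w x} → InAlign lab root g w → ¬ Complete lab root g w →
                        IsDec lab w x → Dom g x
  incomplete⇒assigned {x = x} w∈B[g] incomplete w-x with g x in gx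
  ... | just v = v , refl
  ... | nothing = ⊥-elim (incomplete (w∈B[g] , x , w-x , unassigned , unassigned))
    where
    unassigned : ∀ {c} → Kept lab g x c
    unassigned = unassigned⇒kept lab {g} gx

  complete? : Decidable (Complete lab root g)
  complete? w = star? acyclic (edgeG⇒edge lab) (edgeG? lab g) root w ×-dec both-kept? w
    where
    both-kept? : ∀ w → Dec (∃[ x ] (IsDec lab w x × Kept lab g x false × Kept lab g x true))
    both-kept? w with lab w
    ... | sink _ = no λ { (_ , (_ , _ , ()) , _) }
    ... | conj _ _ = no λ { (_ , (_ , _ , ()) , _) }
    ... | dec x _ _ = map′ (λ kept → x , (_ , _ , refl) , kept) (λ { (_ , (_ , _ , refl) , kept) → kept })
                           (kept? lab g x false ×-dec kept? lab g x true)

  inL? : Decidable (InL lab root g)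
  inL? w = complete? w ×-dec star? acyclic (edgeG⇒edge lab ∘ proj₁) incEdge? root w
    where
    incEdge? : Decidable₂ (IncEdge lab root g)
    incEdge? u v = edgeG? lab g u v ×-dec ¬? (complete? u)

  inSomeL? : ∀ y → Dec (∃[ u ] (InL lab root g u × Var lab u y))
  inSomeL? y = any? λ u → inL? u ×-dec var? lab acyclic u y

  xSet? : Decidable (XSet lab root g)
  xSet? y = var? lab acyclic root y ×-dec ¬? (dom? g y) ×-dec
            all? λ u → inL? u →-dec ¬? (var? lab acyclic u y)

  outside-L⇒X : ∀ {y} → Var lab root y → ¬ Dom g y → ¬ (∃[ u ] (InL lab root g u × Var lab u y)) →
                XSet lab root g y
  outside-L⇒X y∈V y∉g y∉L = y∈V , y∉g , λ u u∈L u-y → y∉L (u , u∈L , u-y)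

  prodL≐cube : (∀ u → ¬ InL lab root g u) → ProdL lab root g ≐ Cube (XSet lab root g)
  prodL≐cube L-empty a = mk⇔ to′ from′
    where
    to′ : ProdL lab root g a → Cube (XSet lab root g) a
    to′ (c , _ , cube , _ , split) y = mk⇔
      (λ (v , ay) → case to (split y v) ay of λ
         { (inj₁ cy) → to (cube y) (v , cy)
         ; (inj₂ (u , u∈L , _)) → ⊥-elim (L-empty u u∈L) })
      (λ y∈X → let (v , cy) = from (cube y) y∈X in v , from (split y v) (inj₁ cy))
    from′ : Cube (XSet lab root g) a → ProdL lab root g a
    from′ cube = a , (λ _ _ → nothing) , cube , (λ u u∈L → ⊥-elim (L-empty u u∈L)) ,
                 λ y v → mk⇔ inj₁ λ { (inj₁ ay) → ay
                                    ; (inj₂ (u , u∈L , _)) → ⊥-elim (L-empty u u∈L) }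

module PrefixAlignment
  {n} (lab : Fin n → Kind n) (acyclic : Acyclic lab) (root : Fin n) (fbdd : IsFBDD lab root)
  (π : List ℕ) (unique : Unique π) (obeys : Obeys lab root π)
  (g : Asg) (k : ℕ) (g-prefix : ∀ x → Dom g x ⇔ x ∈ take k π) where

  open Alignment lab acyclic root g

  private
    V : Pred ℕ 0ℓ
    V = Var lab root

    V? : Decidable V
    V? = var? lab acyclic root

    IncPath : Pred (Fin n) 0ℓ
    IncPath = Star (IncEdge lab root g) root

  before-assigned : ∀ {x y} → Before lab π x y → Dom g y → Dom g x
  before-assigned (i , j , i<j , refl , refl) y∈g =
    from (g-prefix _) (∈-take-before k unique i<j (to (g-prefix _) y∈g))

  L-unassigned : ∀ {u y} → InL lab root g u → Var lab u y → ¬ Dom g y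
  L-unassigned (complete , path) (w , u→w , w-y) y∈g with complete⇒unassigned complete
  ... | x , u-x , gx with star⇒≡⊎⁺ u→w
  ...   | inj₁ refl = nothing⇒∉dom {g} gx (subst (Dom g) (isDec-functional lab w-y u-x) y∈g)
  ...   | inj₂ u→⁺w =
    nothing⇒∉dom {g} gx (before-assigned (obeys _ _ _ _ (incPath⇒reach path) u→⁺w u-x w-y) y∈g)

  L-var⊆V : ∀ {u y} → InL lab root g u → Var lab u y → V y
  L-var⊆V (_ , path) = reach-var lab (incPath⇒reach path)

  Agrees : Asg → Set
  Agrees b = ∀ x v → V x → g x ≡ just v → b x ≡ just v

  module _ {b : Asg} (agrees : Agrees b) where

    descend-step : ∀ {z z′ a} → IncPath z → IncEdge lab root g z z′ → Acc lab z a → a ⊆ₐ b →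
                   ∃[ a′ ] (Acc lab z′ a′ × a′ ⊆ₐ a)
    descend-step {z} path (eg-dec {x = x} c eq kept , incomplete) A a⊆b with acc-dec⁻ lab eq A
    ... | v , a₁ , A₁ , a₁⊆a , ax with incomplete⇒assigned (incPath⇒inAlign path) incomplete (_ , _ , eq)
    ...   | w , gx = a₁ , subst (λ c → Acc lab (pick c _ _) a₁) v≡c A₁ , a₁⊆a
      where
      -- a x = b x = g x = just w, and the edge kept in B[g] is the one labelled w.
      v≡c : v ≡ c
      v≡c = trans (just-injective (trans (sym (a⊆b _ _ ax)) (agrees _ _ x∈V gx))) (kept-value lab {g} kept gx)
        where
        x∈V : V x
        x∈V = z , incPath⇒reach path , _ , _ , eq
    descend-step _ (eg-conj c eq , _) A _ = acc-conj⁻ lab eq A c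

    descend : ∀ {z w a} → IncPath z → Star (IncEdge lab root g) z w → Acc lab z a → a ⊆ₐ b →
              ∃[ a′ ] (Acc lab w a′ × a′ ⊆ₐ a)
    descend _ ε A _ = _ , A , ⊆ₐ-refl
    descend path (e ◅ p) A a⊆b with descend-step path e A a⊆b
    ... | a′ , A′ , a′⊆a with descend (path ◅◅ e ◅ ε) p A′ (⊆ₐ-trans a′⊆a a⊆b)
    ...   | a″ , A″ , a″⊆a′ = a″ , A″ , ⊆ₐ-trans a″⊆a′ a′⊆a

    assemble : (∀ u → InL lab root g u → ∃[ a ] (Acc lab u a × a ⊆ₐ b)) →
               (∀ z → IncPath z → lab z ≢ sink false) →
               ∃[ a ] (Acc lab root a × a ⊆ₐ b)
    assemble acc-L no-0-sink = go root (acyclic⇒noetherian acyclic root) ε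
      where
      go : ∀ z → Accessible (flip (TransClosure (Edge lab))) z → IncPath z →
           ∃[ a ] (Acc lab z a × a ⊆ₐ b)
      go z (accessible rec) path with lab z in eq
      ... | sink true = (λ _ → nothing) , acc-1 eq (λ _ → refl) , λ _ _ ()
      ... | sink false = ⊥-elim (no-0-sink z path eq)
      ... | conj u₀ u₁ =
        let (a₀ , A₀ , a₀⊆b) = child false
            (a₁ , A₁ , a₁⊆b) = child true
        in a₀ ∪ₐ a₁ , acc-conj-∪ lab eq (proj₁ fbdd z u₀ u₁ (incPath⇒reach path) eq) A₀ A₁ ,
           ∪ₐ-⊆ {a₀} {a₁} a₀⊆b a₁⊆b
        where
        incomplete : ¬ Complete lab root g z
        incomplete complete with complete⇒unassigned complete
        ... | _ , (_ , _ , eq′) , _ = case trans (sym eq) eq′ of λ ()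
        child : ∀ c → ∃[ a ] (Acc lab (pick c u₀ u₁) a × a ⊆ₐ b)
        child c = go _ (rec [ e-conj c eq ]) (path ◅◅ (eg-conj c eq , incomplete) ◅ ε)
      ... | dec x u₀ u₁ with g x in gx
      ...   | nothing = acc-L z ((incPath⇒inAlign path , x , (_ , _ , eq) , unassigned , unassigned) , path)
        where
        unassigned : ∀ {c} → Kept lab g x c
        unassigned = unassigned⇒kept lab {g} gx
      ...   | just w =
        let (a₁ , A₁ , a₁⊆b) = go _ (rec [ e-dec w eq ])
                                  (path ◅◅ (eg-dec w eq (assigned⇒kept lab {g} gx) , incomplete) ◅ ε)
        in a₁ ∪ₐ single x w , acc-dec-∪ lab eq x∉child A₁ ,
           ∪ₐ-⊆ {a₁} a₁⊆b (single-⊆ (agrees x w (z , incPath⇒reach path , _ , _ , eq) gx))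
        where
        incomplete : ¬ Complete lab root g z
        incomplete complete with complete⇒unassigned complete
        ... | _ , (_ , _ , eq′) , gx′ with trans (sym eq) eq′
        ...   | refl = case trans (sym gx) gx′ of λ ()
        x∉child : ¬ Var lab (pick w u₀ u₁) x
        x∉child (w′ , child→w′ , w′-x) =
          proj₂ fbdd z w′ x (incPath⇒reach path) (◅⁺ (e-dec w eq) child→w′) (_ , _ , eq) w′-x

  solution⇒no-0-sink : (∃[ a ] Restrict V (Sol lab root) g a) → ∀ z → IncPath z → lab z ≢ sink false
  solution⇒no-0-sink (_ , _ , (_ , a₀ , A₀ , a₀⊆b) , agrees , _) z path eq =
    ¬acc-0-sink lab eq (proj₁ (proj₂ (descend agrees ε path A₀ a₀⊆b)))

  restrict⇒prodL : ∀ {a} → Restrict V (Sol lab root) g a → ProdL lab root g a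
  restrict⇒prodL {a} (b , (b-dom , a₀ , A₀ , a₀⊆b) , agrees , a-null , a≡b) = c , bs , cube , sols , split
    where
    c : Asg
    c = a ↾ xSet?

    bs : Fin n → Asg
    bs u = b ↾ var? lab acyclic u

    V⊆b : ∀ {y} → V y → Dom b y
    V⊆b = from (b-dom _)

    a≡b-outside-g : ∀ {y} → ¬ Dom g y → a y ≡ b y
    a≡b-outside-g y∉g = a≡b _ (y∉g ∘ proj₂)

    a-support : ∀ {y v} → a y ≡ just v → V y × ¬ Dom g y
    a-support {y} {v} ay with V? y | dom? g y
    ... | no y∉V | _ = ⊥-elim (y∉V (to (b-dom y) (v , trans (sym (a≡b y (y∉V ∘ proj₁))) ay)))
    ... | yes y∈V | yes y∈g = case trans (sym (a-null y (y∈V , y∈g))) ay of λ ()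
    ... | yes y∈V | no y∉g = y∈V , y∉g

    cube : Cube (XSet lab root g) c
    cube = ↾-dom xSet? a λ (y∈V , y∉g , _) →
      let (v , by) = V⊆b y∈V in v , trans (a≡b-outside-g y∉g) by

    sols : ∀ u → InL lab root g u → Sol lab u (bs u)
    sols u u∈L with descend agrees ε (proj₂ u∈L) A₀ a₀⊆b
    ... | a′ , A′ , a′⊆a₀ = ↾-dom (var? lab acyclic u) b (V⊆b ∘ L-var⊆V u∈L) , a′ , A′ , a′⊆bu
      where
      a′⊆bu : a′ ⊆ₐ bs u
      a′⊆bu y v a′y =
        trans (↾-inside (var? lab acyclic u) b (acc-var lab A′ (v , a′y))) (a₀⊆b y v (a′⊆a₀ y v a′y))

    split : ∀ y v → a y ≡ just v ⇔ (c y ≡ just v ⊎ ∃[ u ] (InL lab root g u × bs u y ≡ just v))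
    split y v = mk⇔ to′ from′
      where
      to′ : a y ≡ just v → c y ≡ just v ⊎ ∃[ u ] (InL lab root g u × bs u y ≡ just v)
      to′ ay with a-support ay | inSomeL? y
      ... | _ , y∉g | yes (u , u∈L , u-y) =
        inj₂ (u , u∈L , trans (↾-inside (var? lab acyclic u) b u-y) (trans (sym (a≡b-outside-g y∉g)) ay))
      ... | y∈V , y∉g | no y∉L = inj₁ (trans (↾-inside xSet? a (outside-L⇒X y∈V y∉g y∉L)) ay)
      from′ : c y ≡ just v ⊎ ∃[ u ] (InL lab root g u × bs u y ≡ just v) → a y ≡ just v
      from′ (inj₁ cy) = proj₂ (↾-just⁻ xSet? a cy)
      from′ (inj₂ (u , u∈L , bu-y)) =
        let (u-y , by) = ↾-just⁻ (var? lab acyclic u) b bu-y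
        in trans (a≡b-outside-g (L-unassigned u∈L u-y)) by

  prodL⇒restrict : (∃[ a ] Restrict V (Sol lab root) g a) →
                   ∀ {a} → ProdL lab root g a → Restrict V (Sol lab root) g a
  prodL⇒restrict nonempty {a} (c , bs , cube , sols , split) =
    b , (b-dom , assemble agrees acc-L (solution⇒no-0-sink nonempty)) , agrees , a-null , a≡b
    where
    a-support : ∀ {y v} → a y ≡ just v → V y × ¬ Dom g y
    a-support {y} {v} ay with to (split y v) ay
    ... | inj₁ cy = let (y∈V , y∉g , _) = to (cube y) (v , cy) in y∈V , y∉g
    ... | inj₂ (u , u∈L , bu-y) =
      let u-y = to (proj₁ (sols u u∈L) y) (v , bu-y) in L-var⊆V u∈L u-y , L-unassigned u∈L u-y

    gV : Asg
    gV = g ↾ V?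

    b : Asg
    b = gV ∪ₐ a

    disjoint : DisjointAsg gV a
    disjoint y with a y in ay
    ... | nothing = inj₂ refl
    ... | just v = inj₁ (↾-outside V? g (proj₂ (a-support ay) ∘ proj₂))

    a⊆b : a ⊆ₐ b
    a⊆b y v ay = from (∪ₐ-union disjoint y v) (inj₂ ay)

    agrees : Agrees b
    agrees x v x∈V gx = ∪ₐ-justˡ {gV} {a} (trans (↾-inside V? g x∈V) gx)

    a-null : ∀ y → V y × Dom g y → a y ≡ nothing
    a-null y (_ , y∈g) with a y in ay
    ... | nothing = refl
    ... | just v = ⊥-elim (proj₂ (a-support ay) y∈g)

    a≡b : ∀ y → ¬ (V y × Dom g y) → a y ≡ b y
    a≡b y outside = sym (∪ₐ-nothingˡ {gV} {a} (↾-outside V? g outside))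

    V⊆b : ∀ {y} → V y → Dom b y
    V⊆b {y} y∈V with dom? g y | inSomeL? y
    ... | yes (v , gy) | _ = v , agrees y v y∈V gy
    ... | no y∉g | yes (u , u∈L , u-y) =
      let (v , bu-y) = from (proj₁ (sols u u∈L) y) u-y
      in v , a⊆b y v (from (split y v) (inj₂ (u , u∈L , bu-y)))
    ... | no y∉g | no y∉L =
      let (v , cy) = from (cube y) (outside-L⇒X y∈V y∉g y∉L)
      in v , a⊆b y v (from (split y v) (inj₁ cy))

    b-dom : ∀ y → Dom b y ⇔ V y
    b-dom y = mk⇔ (λ (v , by) → case ∪ₐ-just⁻ {gV} {a} by of λ
                     { (inj₁ gV-y) → proj₁ (↾-just⁻ V? g gV-y)
                     ; (inj₂ ay) → proj₁ (a-support ay) })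
                  V⊆b

    acc-L : ∀ u → InL lab root g u → ∃[ a′ ] (Acc lab u a′ × a′ ⊆ₐ b)
    acc-L u u∈L with proj₂ (sols u u∈L)
    ... | a′ , A′ , a′⊆bu =
      a′ , A′ , λ y v a′y → a⊆b y v (from (split y v) (inj₂ (u , u∈L , a′⊆bu y v a′y)))

  restrict≐prodL : (∃[ a ] Restrict V (Sol lab root) g a) → Restrict V (Sol lab root) g ≐ ProdL lab root g
  restrict≐prodL nonempty _ = mk⇔ restrict⇒prodL (prodL⇒restrict nonempty)

lemma3 : ∀ {n} (lab : Fin n → Kind n) (root : Fin n) →
         Acyclic lab → IsFBDD lab root →
         (π : List ℕ) → Unique π → (∀ x → Var lab root x → x ∈ π) →
         Obeys lab root π →
         (g : Asg) → (∃[ k ] (∀ x → Dom g x ⇔ x ∈ take k π)) →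
         (∃[ a ] Restrict (Var lab root) (Sol lab root) g a) →
         ((∃[ u ] InL lab root g u) →
            Restrict (Var lab root) (Sol lab root) g ≐ ProdL lab root g)
         × ((∀ u → ¬ InL lab root g u) →
            Restrict (Var lab root) (Sol lab root) g ≐ Cube (XSet lab root g))
lemma3 lab root acyclic fbdd π unique _ obeys g (k , g-prefix) nonempty =
  (λ _ → restrict≐prodL nonempty) ,
  (λ L-empty a → prodL≐cube L-empty a ⇔-∘ restrict≐prodL nonempty a)
  where
  open Alignment lab acyclic root g using (prodL≐cube)
  open PrefixAlignment lab acyclic root fbdd π unique obeys g k g-prefix using (restrict≐prodL)
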